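{- Let $P:\mathbb{C}\to\mathbb{D}$ be a discrete fibration. For each object $D$ of $\mathbb{D}$ let $P_D:(P\downarrow D)\to\mathbb{D}/D$ be the pullback of $P$ along the domain functor $\operatorname{dom}:\mathbb{D}/D\to\mathbb{D}$. The following are equivalent: (1) for every object $D$ of $\mathbb{D}$, the discrete fibration $P_D$ corresponds to a representable presheaf on $\mathbb{D}/D$; (2) $P$ has a right adjoint; (3) $P$ is comonadic.
   Context: A functor $P:\mathbb{C}\to\mathbb{D}$ is a discrete fibration if for every object $C$ and every morphism $u:D'\to P(C)$ there is a unique morphism $\tilde u$ with codomain $C$ and $P(\tilde u)=u$. Discrete fibrations over a category $\mathbb{A}$ correspond to presheaves on $\mathbb{A}$ (the fibre over $a$ giving the set of elements at $a$); $P_D$ is a discrete fibration since discrete fibrations are stable under pullback. The domain of $P_D$ is the comma category $(P\downarrow D)$. -}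

module Defs where

open import Level using (Level; _⊔_) renaming (suc to lsuc)
open import Data.Product using (Σ; Σ-syntax; _,_; proj₁; proj₂; _×_)
open import Relation.Binary using (Rel; IsEquivalence; Setoid)
open import Relation.Binary.PropositionalEquality using (_≡_; refl)

-- Categories (hom-setoids, objects compared with _≡_ where needed)

record Category (o ℓ e : Level) : Set (lsuc (o ⊔ ℓ ⊔ e)) where
  infix  4 _≈_
  infixr 9 _∘_
  field
    Obj       : Set o
    Hom       : Obj → Obj → Set ℓ
    _≈_       : ∀ {A B} → Rel (Hom A B) e
    id        : ∀ {A} → Hom A A
    _∘_       : ∀ {A B C} → Hom B C → Hom A B → Hom A C
    equiv     : ∀ {A B} → IsEquivalence (_≈_ {A} {B})
    ∘-resp-≈  : ∀ {A B C} {f h : Hom B C} {g i : Hom A B} →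
                f ≈ h → g ≈ i → f ∘ g ≈ h ∘ i
    assoc     : ∀ {A B C D} {f : Hom A B} {g : Hom B C} {h : Hom C D} →
                (h ∘ g) ∘ f ≈ h ∘ (g ∘ f)
    identityˡ : ∀ {A B} {f : Hom A B} → id ∘ f ≈ f
    identityʳ : ∀ {A B} {f : Hom A B} → f ∘ id ≈ f

  module _ {A B : Obj} where
    open IsEquivalence (equiv {A} {B}) public
      renaming (refl to ≈-refl; sym to ≈-sym; trans to ≈-trans)

record Functor {o ℓ e o′ ℓ′ e′ : Level}
               (C : Category o ℓ e) (D : Category o′ ℓ′ e′)
               : Set (o ⊔ ℓ ⊔ e ⊔ o′ ⊔ ℓ′ ⊔ e′) where
  private
    module C = Category C
    module D = Category D
  field
    F₀           : C.Obj → D.Obj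
    F₁           : ∀ {A B} → C.Hom A B → D.Hom (F₀ A) (F₀ B)
    identity     : ∀ {A} → F₁ (C.id {A}) D.≈ D.id
    homomorphism : ∀ {X Y Z} {f : C.Hom X Y} {g : C.Hom Y Z} →
                   F₁ (g C.∘ f) D.≈ F₁ g D.∘ F₁ f
    F-resp-≈     : ∀ {A B} {f g : C.Hom A B} → f C.≈ g → F₁ f D.≈ F₁ g

module _ {o ℓ e o′ ℓ′ e′ o″ ℓ″ e″ : Level}
         {C : Category o ℓ e} {D : Category o′ ℓ′ e′} {E : Category o″ ℓ″ e″} where
  private
    module D = Category D
    module E = Category E
  open Functor

  _∘F_ : Functor D E → Functor C D → Functor C E
  G ∘F F = record
    { F₀ = λ X → F₀ G (F₀ F X)
    ; F₁ = λ f → F₁ G (F₁ F f)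
    ; identity = E.≈-trans (F-resp-≈ G (identity F)) (identity G)
    ; homomorphism = E.≈-trans (F-resp-≈ G (homomorphism F)) (homomorphism G)
    ; F-resp-≈ = λ p → F-resp-≈ G (F-resp-≈ F p)
    }

idF : ∀ {o ℓ e} {C : Category o ℓ e} → Functor C C
idF {C = C} = record
  { F₀ = λ X → X ; F₁ = λ f → f
  ; identity = ≈-refl ; homomorphism = ≈-refl ; F-resp-≈ = λ p → p }
  where open Category C

record NaturalIsomorphism {o ℓ e o′ ℓ′ e′ : Level}
         {C : Category o ℓ e} {D : Category o′ ℓ′ e′} (F G : Functor C D)
         : Set (o ⊔ ℓ ⊔ e ⊔ o′ ⊔ ℓ′ ⊔ e′) where
  private
    module C = Category C
    module D = Category D
    module F = Functor F
    module G = Functor G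
  field
    η        : ∀ X → D.Hom (F.F₀ X) (G.F₀ X)
    η⁻¹      : ∀ X → D.Hom (G.F₀ X) (F.F₀ X)
    isoˡ     : ∀ X → η⁻¹ X D.∘ η X D.≈ D.id
    isoʳ     : ∀ X → η X D.∘ η⁻¹ X D.≈ D.id
    natural  : ∀ {X Y} (f : C.Hom X Y) → η Y D.∘ F.F₁ f D.≈ G.F₁ f D.∘ η X

record IsEquivalenceOfCategories {o ℓ e o′ ℓ′ e′ : Level}
         {C : Category o ℓ e} {D : Category o′ ℓ′ e′} (F : Functor C D)
         : Set (o ⊔ ℓ ⊔ e ⊔ o′ ⊔ ℓ′ ⊔ e′) where
  field
    G     : Functor D C
    F∘G≅1 : NaturalIsomorphism (F ∘F G) idF
    G∘F≅1 : NaturalIsomorphism (G ∘F F) idF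

-- "f lies over g" along equalities of the domain and codomain objects
HomOver : ∀ {o ℓ e} (D : Category o ℓ e) {X X′ Y Y′ : Category.Obj D} →
          X ≡ X′ → Y ≡ Y′ → Category.Hom D X Y → Category.Hom D X′ Y′ → Set e
HomOver D refl refl f g = Category._≈_ D f g

module _ {o ℓ e o′ ℓ′ e′ : Level}
         {C : Category o ℓ e} {D : Category o′ ℓ′ e′} (P : Functor C D) where
  private
    module C = Category C
    module D = Category D
  open Functor P

  Lift : ∀ {D′ : D.Obj} (X : C.Obj) → D.Hom D′ (F₀ X) → Set (o ⊔ ℓ ⊔ o′ ⊔ e′)
  Lift {D′} X u = Σ[ X′ ∈ C.Obj ] Σ[ ũ ∈ C.Hom X′ X ]
                  Σ[ p ∈ F₀ X′ ≡ D′ ] HomOver D p refl (F₁ ũ) u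

  record IsDiscreteFibration : Set (o ⊔ ℓ ⊔ e ⊔ o′ ⊔ ℓ′ ⊔ e′) where
    field
      lift    : ∀ {D′} (X : C.Obj) (u : D.Hom D′ (F₀ X)) → Lift X u
      unique  : ∀ {D′} (X : C.Obj) (u : D.Hom D′ (F₀ X)) (l₁ l₂ : Lift X u) →
                Σ[ q ∈ proj₁ l₁ ≡ proj₁ l₂ ]
                  HomOver C q refl (proj₁ (proj₂ l₁)) (proj₁ (proj₂ l₂))

  -- The presheaf on D corresponding to a discrete fibration P:
  -- its set of elements at a is the fibre P⁻¹(a), with equality of
  -- elements = equality of objects of C; the action of u : a′ → a sends
  -- x ∈ P⁻¹(a) to the domain of the (unique) lift of u at x.

  Fibre : D.Obj → Set (o ⊔ o′)
  Fibre a = Σ[ X ∈ C.Obj ] F₀ X ≡ a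

  -- x′ = u*(x) : there is a morphism x′ → x over u
  IsReindexing : ∀ {a′ a} → D.Hom a′ a → Fibre a′ → Fibre a → Set (ℓ ⊔ e′)
  IsReindexing u (X′ , p′) (X , p) = Σ[ ũ ∈ C.Hom X′ X ] HomOver D p′ p (F₁ ũ) u

  -- the presheaf of P is naturally isomorphic to the representable D(-, r)
  record RepresentedBy (r : D.Obj) : Set (o ⊔ ℓ ⊔ o′ ⊔ ℓ′ ⊔ e′) where
    field
      φ       : ∀ {a} → Fibre a → D.Hom a r
      φ-resp  : ∀ {a} (x y : Fibre a) → proj₁ x ≡ proj₁ y → φ x D.≈ φ y
      φ-inj   : ∀ {a} (x y : Fibre a) → φ x D.≈ φ y → proj₁ x ≡ proj₁ y
      φ-surj  : ∀ {a} (h : D.Hom a r) → Σ[ x ∈ Fibre a ] φ x D.≈ h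
      natural : ∀ {a′ a} (u : D.Hom a′ a) (x′ : Fibre a′) (x : Fibre a) →
                IsReindexing u x′ x → φ x′ D.≈ φ x D.∘ u

  CorrespondsToRepresentable : Set (o ⊔ ℓ ⊔ o′ ⊔ ℓ′ ⊔ e′)
  CorrespondsToRepresentable = Σ[ r ∈ D.Obj ] RepresentedBy r

module _ {o ℓ e o′ ℓ′ e′ : Level}
         {C : Category o ℓ e} {D : Category o′ ℓ′ e′} (P : Functor C D) where
  private
    module C = Category C
    module D = Category D
  open Functor P

  Comma : (d : D.Obj) → Category (o ⊔ ℓ′) (ℓ ⊔ e′) e
  Comma d = record
    { Obj = Σ[ X ∈ C.Obj ] D.Hom (F₀ X) d
    ; Hom = λ { (X , g) (Y , g′) → Σ[ k ∈ C.Hom X Y ] g′ D.∘ F₁ k D.≈ g }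
    ; _≈_ = λ k k′ → proj₁ k C.≈ proj₁ k′
    ; id = λ { {X , g} → C.id , D.≈-trans (D.∘-resp-≈ D.≈-refl identity) D.identityʳ }
    ; _∘_ = λ { {X , g} {Y , g′} {Z , g″} (k′ , q′) (k , q) →
               k′ C.∘ k ,
               D.≈-trans (D.∘-resp-≈ D.≈-refl homomorphism)
               (D.≈-trans (D.≈-sym D.assoc)
               (D.≈-trans (D.∘-resp-≈ q′ D.≈-refl) q)) }
    ; equiv = record { refl = C.≈-refl ; sym = C.≈-sym ; trans = C.≈-trans }
    ; ∘-resp-≈ = C.∘-resp-≈
    ; assoc = C.assoc
    ; identityˡ = C.identityˡ
    ; identityʳ = C.identityʳ
    }

Slice : ∀ {o ℓ e} (D : Category o ℓ e) (d : Category.Obj D) → Category (o ⊔ ℓ) (ℓ ⊔ e) e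
Slice D d = Comma (idF {C = D}) d

Dom : ∀ {o ℓ e} (D : Category o ℓ e) (d : Category.Obj D) → Functor (Slice D d) D
Dom D d = record
  { F₀ = proj₁ ; F₁ = proj₁
  ; identity = ≈-refl ; homomorphism = ≈-refl ; F-resp-≈ = λ p → p }
  where open Category D

-- P_d : (P ↓ d) → D/d, the pullback of P along dom : D/d → D
-- (its domain is the comma category (P ↓ d))
PullbackAlongDom : ∀ {o ℓ e o′ ℓ′ e′}
  {C : Category o ℓ e} {D : Category o′ ℓ′ e′} (P : Functor C D) (d : Category.Obj D) →
  Functor (Comma P d) (Slice D d)
PullbackAlongDom {D = D} P d = record
  { F₀ = λ { (X , g) → F₀ X , g }
  ; F₁ = λ { (k , q) → F₁ k , q }
  ; identity = identity
  ; homomorphism = homomorphism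
  ; F-resp-≈ = F-resp-≈
  }
  where open Functor P

record Adjunction {o ℓ e o′ ℓ′ e′ : Level}
         {C : Category o ℓ e} {D : Category o′ ℓ′ e′}
         (L : Functor C D) (R : Functor D C) : Set (o ⊔ ℓ ⊔ e ⊔ o′ ⊔ ℓ′ ⊔ e′) where
  private
    module C = Category C
    module D = Category D
    module L = Functor L
    module R = Functor R
  field
    unit      : ∀ X → C.Hom X (R.F₀ (L.F₀ X))
    counit    : ∀ Y → D.Hom (L.F₀ (R.F₀ Y)) Y
    unit-nat  : ∀ {X Y} (f : C.Hom X Y) →
                unit Y C.∘ f C.≈ R.F₁ (L.F₁ f) C.∘ unit X
    counit-nat : ∀ {X Y} (f : D.Hom X Y) →
                counit Y D.∘ L.F₁ (R.F₁ f) D.≈ f D.∘ counit X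
    zig       : ∀ X → counit (L.F₀ X) D.∘ L.F₁ (unit X) D.≈ D.id
    zag       : ∀ Y → R.F₁ (counit Y) C.∘ unit (R.F₀ Y) C.≈ C.id

module _ {o ℓ e o′ ℓ′ e′ : Level}
         {C : Category o ℓ e} {D : Category o′ ℓ′ e′}
         {L : Functor C D} {R : Functor D C} (adj : Adjunction L R) where
  private
    module C = Category C
    module D = Category D
    module L = Functor L
    module R = Functor R
    open Adjunction adj

    -- the comonad G = L R with counit ε = counit and comultiplication δ = L η R
    G₀ : D.Obj → D.Obj
    G₀ Y = L.F₀ (R.F₀ Y)
    G₁ : ∀ {X Y} → D.Hom X Y → D.Hom (G₀ X) (G₀ Y)
    G₁ f = L.F₁ (R.F₁ f)
    δ : ∀ Y → D.Hom (G₀ Y) (G₀ (G₀ Y))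
    δ Y = L.F₁ (unit (R.F₀ Y))

  record Coalgebra : Set (o′ ⊔ ℓ′ ⊔ e′) where
    field
      carrier : D.Obj
      coact   : D.Hom carrier (G₀ carrier)
      counit-law : counit carrier D.∘ coact D.≈ D.id
      coassoc    : δ carrier D.∘ coact D.≈ G₁ coact D.∘ coact

  open Coalgebra

  private
    G-hom : ∀ {X Y Z} {f : D.Hom X Y} {g : D.Hom Y Z} → G₁ (g D.∘ f) D.≈ G₁ g D.∘ G₁ f
    G-hom = D.≈-trans (L.F-resp-≈ R.homomorphism) L.homomorphism
    G-id : ∀ {X} → G₁ (D.id {X}) D.≈ D.id
    G-id = D.≈-trans (L.F-resp-≈ R.identity) L.identity

  Coalgebras : Category (o′ ⊔ ℓ′ ⊔ e′) (ℓ′ ⊔ e′) e′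
  Coalgebras = record
    { Obj = Coalgebra
    ; Hom = λ A B → Σ[ f ∈ D.Hom (carrier A) (carrier B) ]
                      coact B D.∘ f D.≈ G₁ f D.∘ coact A
    ; _≈_ = λ f g → proj₁ f D.≈ proj₁ g
    ; id = λ {A} → D.id ,
             D.≈-trans D.identityʳ
             (D.≈-trans (D.≈-sym D.identityˡ) (D.∘-resp-≈ (D.≈-sym G-id) D.≈-refl))
    ; _∘_ = λ { {A} {B} {Cc} (g , q) (f , p) → g D.∘ f ,
        D.≈-trans (D.≈-sym D.assoc)
        (D.≈-trans (D.∘-resp-≈ q D.≈-refl)
        (D.≈-trans D.assoc
        (D.≈-trans (D.∘-resp-≈ D.≈-refl p)
        (D.≈-trans (D.≈-sym D.assoc)
        (D.∘-resp-≈ (D.≈-sym G-hom) D.≈-refl))))) }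
    ; equiv = record { refl = D.≈-refl ; sym = D.≈-sym ; trans = D.≈-trans }
    ; ∘-resp-≈ = D.∘-resp-≈
    ; assoc = D.assoc
    ; identityˡ = D.identityˡ
    ; identityʳ = D.identityʳ
    }

  Comparison : Functor C Coalgebras
  Comparison = record
    { F₀ = λ X → record
        { carrier = L.F₀ X
        ; coact = L.F₁ (unit X)
        ; counit-law = zig X
        ; coassoc = D.≈-trans (D.≈-sym L.homomorphism)
                    (D.≈-trans (L.F-resp-≈ (unit-nat (unit X))) L.homomorphism)
        }
    ; F₁ = λ {X} {Y} k → L.F₁ k ,
        D.≈-trans (D.≈-sym L.homomorphism)
        (D.≈-trans (L.F-resp-≈ (unit-nat k)) L.homomorphism)
    ; identity = L.identity
    ; homomorphism = L.homomorphism
    ; F-resp-≈ = L.F-resp-≈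
    }

module _ {o ℓ e o′ ℓ′ e′ : Level}
         {C : Category o ℓ e} {D : Category o′ ℓ′ e′} (P : Functor C D) where

  HasRightAdjoint : Set (o ⊔ ℓ ⊔ e ⊔ o′ ⊔ ℓ′ ⊔ e′)
  HasRightAdjoint = Σ[ R ∈ Functor D C ] Adjunction P R

  IsComonadic : Set (o ⊔ ℓ ⊔ e ⊔ o′ ⊔ ℓ′ ⊔ e′)
  IsComonadic = Σ[ R ∈ Functor D C ] Σ[ adj ∈ Adjunction P R ]
                  IsEquivalenceOfCategories (Comparison adj)

{-# OPTIONS --safe #-}
module Submission where

open import Defs
open import Level using (Level; _⊔_)
open import Data.Product using (_×_; Σ-syntax; _,_; proj₁; proj₂)
open import Relation.Binary using (Setoid)
open import Relation.Binary.PropositionalEquality using (_≡_; refl; sym; cong; subst)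

-- Conditions (1) and (2) both say that every comma category (P ↓ d) has a terminal
-- object: a right adjoint of P is a choice of universal arrow P R d → d for each d,
-- and a terminal object of (P ↓ d) represents the presheaf of the discrete fibration
-- P_d, because reindexing in P_d is composition in (P ↓ d).  For (3), the unique
-- lift of a coalgebra structure α : A → P R A is a morphism X → R A of C with
-- P X = A; sending (A , α) to X inverts the comparison functor, and since unique
-- lifting makes P faithful, every required equation can be checked after P.

module HomReasoning {o ℓ e} (𝒞 : Category o ℓ e) where
  open Category 𝒞

  hom-setoid : Obj → Obj → Setoid ℓ e
  hom-setoid A B = record { Carrier = Hom A B ; _≈_ = _≈_ ; isEquivalence = equiv }

  module _ {A B : Obj} where
    open import Relation.Binary.Reasoning.Setoid (hom-setoid A B) public

  infixr 4 _⟩∘⟨_ refl⟩∘⟨_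
  infixl 5 _⟩∘⟨refl

  _⟩∘⟨_ : ∀ {A B C} {f h : Hom B C} {g i : Hom A B} → f ≈ h → g ≈ i → f ∘ g ≈ h ∘ i
  _⟩∘⟨_ = ∘-resp-≈

  refl⟩∘⟨_ : ∀ {A B C} {f : Hom B C} {g i : Hom A B} → g ≈ i → f ∘ g ≈ f ∘ i
  refl⟩∘⟨ q = ∘-resp-≈ ≈-refl q

  _⟩∘⟨refl : ∀ {A B C} {f h : Hom B C} {g : Hom A B} → f ≈ h → f ∘ g ≈ h ∘ g
  q ⟩∘⟨refl = ∘-resp-≈ q ≈-refl

  pullˡ : ∀ {A B C D} {a : Hom C D} {b : Hom B C} {c : Hom B D} {f : Hom A B} →
          a ∘ b ≈ c → a ∘ (b ∘ f) ≈ c ∘ f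
  pullˡ q = ≈-trans (≈-sym assoc) (q ⟩∘⟨refl)

  pullʳ : ∀ {A B C D} {a : Hom C D} {b : Hom B C} {f : Hom A B} {c : Hom A C} →
          b ∘ f ≈ c → (a ∘ b) ∘ f ≈ a ∘ c
  pullʳ q = ≈-trans assoc (refl⟩∘⟨ q)

module Transport {o ℓ e} (𝒞 : Category o ℓ e) where
  open Category 𝒞

  ≡⇒Hom : ∀ {A B} → A ≡ B → Hom A B
  ≡⇒Hom refl = id

  transport : ∀ {A A′ B B′} → A′ ≡ A → B′ ≡ B → Hom A B → Hom A′ B′
  transport refl refl f = f

  ≡⇒Hom-invˡ : ∀ {A B} (p : A ≡ B) → ≡⇒Hom (sym p) ∘ ≡⇒Hom p ≈ id
  ≡⇒Hom-invˡ refl = identityˡ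

  ≡⇒Hom-invʳ : ∀ {A B} (p : A ≡ B) → ≡⇒Hom p ∘ ≡⇒Hom (sym p) ≈ id
  ≡⇒Hom-invʳ refl = identityˡ

  HomOver⇒≈ : ∀ {A A′ B B′} (p : A ≡ A′) (q : B ≡ B′) {f : Hom A B} {g : Hom A′ B′} →
              HomOver 𝒞 p q f g → f ≈ transport p q g
  HomOver⇒≈ refl refl h = h

  ≈⇒HomOver : ∀ {A A′ B B′} (p : A ≡ A′) (q : B ≡ B′) {f : Hom A B} {g : Hom A′ B′} →
              f ≈ transport p q g → HomOver 𝒞 p q f g
  ≈⇒HomOver refl refl h = h

  transport-resp : ∀ {A A′ B B′} (p : A′ ≡ A) (q : B′ ≡ B) {f g : Hom A B} →
                   f ≈ g → transport p q f ≈ transport p q g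
  transport-resp refl refl h = h

  transport-id : ∀ {A A′} (p : A′ ≡ A) → transport p p id ≈ id
  transport-id refl = ≈-refl

  transport-∘ : ∀ {A A′ B B′ C C′} (p : A′ ≡ A) (q : B′ ≡ B) (r : C′ ≡ C)
                {f : Hom A B} {g : Hom B C} →
                transport p r (g ∘ f) ≈ transport q r g ∘ transport p q f
  transport-∘ refl refl refl = ≈-refl

  ≡⇒Hom-natural : ∀ {A A′ B B′} (p : A′ ≡ A) (q : B′ ≡ B) {f : Hom A B} →
                  ≡⇒Hom q ∘ transport p q f ≈ f ∘ ≡⇒Hom p
  ≡⇒Hom-natural refl refl = ≈-trans identityˡ (≈-sym identityʳ)

module _ {o ℓ e o′ ℓ′ e′ : Level} {C : Category o ℓ e} {D : Category o′ ℓ′ e′}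
         (F : Functor C D) where
  private module D = Category D
  open Functor F
  open Transport

  F₁-≡⇒Hom : ∀ {X Y} (q : X ≡ Y) (p : F₀ X ≡ F₀ Y) → F₁ (≡⇒Hom C q) D.≈ ≡⇒Hom D p
  F₁-≡⇒Hom refl refl = identity

module _ {o ℓ e} {C : Category o ℓ e} (F : Functor C C) where
  open Category C
  open Functor F
  open HomReasoning C

  iso-square⁻¹ : ∀ {X Y} {i : Hom X Y} {j : Hom Y X} {α : Hom Y (F₀ Y)} {β : Hom X (F₀ X)} →
                 j ∘ i ≈ id → i ∘ j ≈ id → α ∘ i ≈ F₁ i ∘ β → β ∘ j ≈ F₁ j ∘ α
  iso-square⁻¹ {i = i} {j} {α} {β} ji ij sq = begin
    β ∘ j                       ≈⟨ ≈-sym identityˡ ⟩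
    id ∘ (β ∘ j)                ≈⟨ ≈-sym (≈-trans (F-resp-≈ ji) identity) ⟩∘⟨refl ⟩
    F₁ (j ∘ i) ∘ (β ∘ j)        ≈⟨ homomorphism ⟩∘⟨refl ⟩
    (F₁ j ∘ F₁ i) ∘ (β ∘ j)     ≈⟨ pullʳ (pullˡ (≈-sym sq)) ⟩
    F₁ j ∘ ((α ∘ i) ∘ j)        ≈⟨ refl⟩∘⟨ pullʳ ij ⟩
    F₁ j ∘ (α ∘ id)             ≈⟨ refl⟩∘⟨ identityʳ ⟩
    F₁ j ∘ α                    ∎

module DiscreteFibration {o ℓ e o′ ℓ′ e′ : Level}
         {C : Category o ℓ e} {D : Category o′ ℓ′ e′} (P : Functor C D)
         (fib : IsDiscreteFibration P) where
  private
    module C = Category C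
    module D = Category D
  open Functor P
  open IsDiscreteFibration fib
  open Transport D
  open HomReasoning D

  -- Matching refl against equations such as X ≡ X or F₀ X ≡ F₀ X relies on K.
  faithful : ∀ {X Z} {k k′ : C.Hom X Z} → F₁ k D.≈ F₁ k′ → k C.≈ k′
  faithful {X} {Z} {k} {k′} h with unique Z (F₁ k′) (X , k , refl , h) (X , k′ , refl , D.≈-refl)
  ... | refl , k≈k′ = k≈k′

  lift-over-self : ∀ {X Z} {u : D.Hom (F₀ X) (F₀ Z)} (l : Lift P Z u) → proj₁ l ≡ X →
                   Σ[ k ∈ C.Hom X Z ] F₁ k D.≈ u
  lift-over-self (_ , k , refl , k-over-u) refl = k , k-over-u

  -- Lift u at Z to k : X′ → Z; then t ∘ k and s both lift P s at W, so X′ = X.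
  factor-lifts : ∀ {X Z W} (u : D.Hom (F₀ X) (F₀ Z)) {t : C.Hom Z W} {s : C.Hom X W} →
                 F₁ t D.∘ u D.≈ F₁ s → Σ[ k ∈ C.Hom X Z ] F₁ k D.≈ u
  factor-lifts {X} {Z} {W} u {t} {s} tu≈s =
    lift-over-self l
      (proj₁ (unique W (F₁ s) (X′ , t C.∘ k , p , tk-over-s) (X , s , refl , D.≈-refl)))
    where
      l : Lift P Z u
      l = lift Z u
      X′ : C.Obj
      X′ = proj₁ l
      k : C.Hom X′ Z
      k = proj₁ (proj₂ l)
      p : F₀ X′ ≡ F₀ X
      p = proj₁ (proj₂ (proj₂ l))
      k-over-u : HomOver D p refl (F₁ k) u
      k-over-u = proj₂ (proj₂ (proj₂ l))
      tk-over-s : HomOver D p refl (F₁ (t C.∘ k)) (F₁ s)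
      tk-over-s = ≈⇒HomOver p refl (begin
        F₁ (t C.∘ k)                     ≈⟨ homomorphism ⟩
        F₁ t D.∘ F₁ k                    ≈⟨ refl⟩∘⟨ HomOver⇒≈ p refl k-over-u ⟩
        F₁ t D.∘ transport p refl u      ≈⟨ D.≈-sym (transport-∘ p refl refl) ⟩
        transport p refl (F₁ t D.∘ u)    ≈⟨ transport-resp p refl tu≈s ⟩
        transport p refl (F₁ s)          ∎)

module _ {o ℓ e o′ ℓ′ e′ : Level} {C : Category o ℓ e} {D : Category o′ ℓ′ e′}
         (P : Functor C D) where
  private
    module C = Category C
    module D = Category D
    module P = Functor P

  record UniversalArrow (d : D.Obj) : Set (o ⊔ ℓ ⊔ e ⊔ ℓ′ ⊔ e′) where
    field
      obj                : C.Obj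
      ε                  : D.Hom (P.F₀ obj) d
      transpose          : ∀ {X} → D.Hom (P.F₀ X) d → C.Hom X obj
      transpose-commutes : ∀ {X} (g : D.Hom (P.F₀ X) d) → ε D.∘ P.F₁ (transpose g) D.≈ g
      transpose-unique   : ∀ {X} {g : D.Hom (P.F₀ X) d} (k : C.Hom X obj) →
                           ε D.∘ P.F₁ k D.≈ g → k C.≈ transpose g

    transpose-unique₂ : ∀ {X} {g : D.Hom (P.F₀ X) d} {k k′ : C.Hom X obj} →
                        ε D.∘ P.F₁ k D.≈ g → ε D.∘ P.F₁ k′ D.≈ g → k C.≈ k′
    transpose-unique₂ h h′ = C.≈-trans (transpose-unique _ h) (C.≈-sym (transpose-unique _ h′))

  module _ {R : Functor D C} (adj : Adjunction P R) where
    private module R = Functor R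
    open Adjunction adj

    adjunction⇒universalArrow : ∀ d → UniversalArrow d
    adjunction⇒universalArrow d = record
      { obj                = R.F₀ d
      ; ε                  = counit d
      ; transpose          = λ {X} g → R.F₁ g C.∘ unit X
      ; transpose-commutes = commutes
      ; transpose-unique   = unique
      }
      where
        commutes : ∀ {X} (g : D.Hom (P.F₀ X) d) → counit d D.∘ P.F₁ (R.F₁ g C.∘ unit X) D.≈ g
        commutes {X} g = begin
          counit d D.∘ P.F₁ (R.F₁ g C.∘ unit X)            ≈⟨ refl⟩∘⟨ P.homomorphism ⟩
          counit d D.∘ (P.F₁ (R.F₁ g) D.∘ P.F₁ (unit X))   ≈⟨ pullˡ (counit-nat g) ⟩
          (g D.∘ counit (P.F₀ X)) D.∘ P.F₁ (unit X)        ≈⟨ pullʳ (zig X) ⟩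
          g D.∘ D.id                                       ≈⟨ D.identityʳ ⟩
          g                                                ∎
          where open HomReasoning D

        unique : ∀ {X} {g : D.Hom (P.F₀ X) d} (k : C.Hom X (R.F₀ d)) →
                 counit d D.∘ P.F₁ k D.≈ g → k C.≈ R.F₁ g C.∘ unit X
        unique {X} {g} k h = begin
          k                                                  ≈⟨ C.≈-sym C.identityˡ ⟩
          C.id C.∘ k                                         ≈⟨ C.≈-sym (zag d) ⟩∘⟨refl ⟩
          (R.F₁ (counit d) C.∘ unit (R.F₀ d)) C.∘ k          ≈⟨ pullʳ (unit-nat k) ⟩
          R.F₁ (counit d) C.∘ (R.F₁ (P.F₁ k) C.∘ unit X)     ≈⟨ pullˡ (C.≈-sym R.homomorphism) ⟩
          R.F₁ (counit d D.∘ P.F₁ k) C.∘ unit X              ≈⟨ R.F-resp-≈ h ⟩∘⟨refl ⟩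
          R.F₁ g C.∘ unit X                                  ∎
          where open HomReasoning C

  module _ (U : ∀ d → UniversalArrow d) where
    open module Arrow {d} = UniversalArrow (U d)

    private
      R₁ : ∀ {d d′} → D.Hom d d′ → C.Hom (obj {d}) (obj {d′})
      R₁ {d} f = transpose (f D.∘ ε {d})

      R₁-after : ∀ {X d d′} (f : D.Hom d d′) (k : C.Hom X (obj {d})) →
                 ε D.∘ P.F₁ (R₁ f C.∘ k) D.≈ f D.∘ (ε D.∘ P.F₁ k)
      R₁-after f k = begin
        ε D.∘ P.F₁ (R₁ f C.∘ k)                ≈⟨ refl⟩∘⟨ P.homomorphism ⟩
        ε D.∘ (P.F₁ (R₁ f) D.∘ P.F₁ k)         ≈⟨ pullˡ (transpose-commutes _) ⟩
        (f D.∘ ε) D.∘ P.F₁ k                   ≈⟨ D.assoc ⟩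
        f D.∘ (ε D.∘ P.F₁ k)                   ∎
        where open HomReasoning D

    universalArrows⇒rightAdjoint : HasRightAdjoint P
    universalArrows⇒rightAdjoint = R , record
      { unit       = λ X → transpose D.id
      ; counit     = λ d → ε
      ; unit-nat   = λ f → transpose-unique₂
          (D.≈-trans (refl⟩∘⟨ P.homomorphism)
            (D.≈-trans (pullˡ (transpose-commutes D.id)) D.identityˡ))
          (D.≈-trans (R₁-after (P.F₁ f) (transpose D.id))
            (D.≈-trans (refl⟩∘⟨ transpose-commutes D.id) D.identityʳ))
      ; counit-nat = λ f → transpose-commutes _
      ; zig        = λ X → transpose-commutes D.id
      ; zag        = λ d → transpose-unique₂
          (D.≈-trans (R₁-after ε (transpose D.id))
            (D.≈-trans (refl⟩∘⟨ transpose-commutes D.id) D.identityʳ))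
          (D.≈-trans (refl⟩∘⟨ P.identity) D.identityʳ)
      }
      where
        open HomReasoning D
        R : Functor D C
        R = record
          { F₀           = λ d → obj {d}
          ; F₁           = R₁
          ; identity     = C.≈-sym (transpose-unique C.id
              (D.≈-trans (refl⟩∘⟨ P.identity) (D.≈-trans D.identityʳ (D.≈-sym D.identityˡ))))
          ; homomorphism = λ {_} {_} {_} {f} {g} → C.≈-sym (transpose-unique _
              (D.≈-trans (R₁-after g (R₁ f))
                (D.≈-trans (refl⟩∘⟨ transpose-commutes _) (D.≈-sym D.assoc))))
          ; F-resp-≈     = λ {_} {_} {f} f≈g → transpose-unique _
              (D.≈-trans (transpose-commutes _) (f≈g ⟩∘⟨refl))
          }

module Representability {o ℓ e o′ ℓ′ e′ : Level}
         {C : Category o ℓ e} {D : Category o′ ℓ′ e′} (P : Functor C D)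
         (fib : IsDiscreteFibration P) (d : Category.Obj D) where
  private
    module C = Category C
    module D = Category D
    module P = Functor P
    module S = Category (Slice D d)
    module P↓d = Category (Comma P d)
    PD = PullbackAlongDom P d
  open IsDiscreteFibration fib
  open DiscreteFibration P fib using (faithful)
  open HomReasoning D

  fibre-≡ : ∀ {a} (x y : Fibre PD a) → proj₁ (proj₁ x) ≡ proj₁ (proj₁ y) → proj₁ x ≡ proj₁ y
  fibre-≡ (_ , refl) (_ , refl) refl = refl

  universalArrow⇒representable : UniversalArrow P d → CorrespondsToRepresentable PD
  universalArrow⇒representable U = (P.F₀ obj , ε) , record
    { φ       = φ
    ; φ-resp  = φ-resp
    ; φ-inj   = φ-inj
    ; φ-surj  = λ h → φ-surj h (lift obj (proj₁ h))
    ; natural = φ-natural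
    }
    where
      open UniversalArrow U

      φ : ∀ {a} → Fibre PD a → S.Hom a (P.F₀ obj , ε)
      φ ((X , g) , refl) = P.F₁ (transpose g) , transpose-commutes g

      φ-resp : ∀ {a} (x y : Fibre PD a) → proj₁ x ≡ proj₁ y → φ x S.≈ φ y
      φ-resp (_ , refl) (_ , refl) refl = D.≈-refl

      φ-lift : ∀ {a} (x : Fibre PD a) {u : D.Hom (proj₁ a) (P.F₀ obj)} → proj₁ (φ x) D.≈ u →
               Lift P obj u
      φ-lift ((X , g) , p) φx≈u = X , transpose g , cong proj₁ p , over p φx≈u
        where
          over : ∀ {a} (p : (P.F₀ X , g) ≡ a) {u : D.Hom (proj₁ a) (P.F₀ obj)} →
                 proj₁ (φ ((X , g) , p)) D.≈ u → HomOver D (cong proj₁ p) refl (P.F₁ (transpose g)) u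
          over refl φx≈u = φx≈u

      φ-inj : ∀ {a} (x y : Fibre PD a) → φ x S.≈ φ y → proj₁ x ≡ proj₁ y
      φ-inj x y φx≈φy =
        fibre-≡ x y (proj₁ (unique obj _ (φ-lift x D.≈-refl) (φ-lift y (D.≈-sym φx≈φy))))

      φ-surj : ∀ {a} {g : D.Hom a d} (h : S.Hom (a , g) (P.F₀ obj , ε)) → Lift P obj (proj₁ h) →
               Σ[ x ∈ Fibre PD (a , g) ] φ x S.≈ h
      φ-surj {g = g} (h , εh≈g) (X , k , refl , Pk≈h) = ((X , g) , refl) , (begin
        P.F₁ (transpose g)  ≈⟨ P.F-resp-≈ (C.≈-sym (transpose-unique k εk≈g)) ⟩
        P.F₁ k              ≈⟨ Pk≈h ⟩
        h                   ∎)
        where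
          εk≈g : ε D.∘ P.F₁ k D.≈ g
          εk≈g = D.≈-trans (refl⟩∘⟨ Pk≈h) εh≈g

      φ-natural : ∀ {a′ a} (u : S.Hom a′ a) (x′ : Fibre PD a′) (x : Fibre PD a) →
                  IsReindexing PD u x′ x → φ x′ S.≈ φ x S.∘ u
      φ-natural (u , _) ((X′ , g′) , refl) ((X , g) , refl) ((k , gk≈g′) , Pk≈u) = begin
        P.F₁ (transpose g′)          ≈⟨ P.F-resp-≈ (C.≈-sym (transpose-unique _ εtk≈g′)) ⟩
        P.F₁ (transpose g C.∘ k)     ≈⟨ P.homomorphism ⟩
        P.F₁ (transpose g) D.∘ P.F₁ k ≈⟨ refl⟩∘⟨ Pk≈u ⟩
        P.F₁ (transpose g) D.∘ u     ∎
        where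
          εtk≈g′ : ε D.∘ P.F₁ (transpose g C.∘ k) D.≈ g′
          εtk≈g′ = D.≈-trans (refl⟩∘⟨ P.homomorphism)
                     (D.≈-trans (pullˡ (transpose-commutes g)) gk≈g′)

  -- An element x = (X₀ , g₀) with φ x = id is terminal in (P ↓ d): by naturality, a
  -- comma map (X , g) → x lies over φ (X , g); one exists because the lift of φ (X , g)
  -- at X₀ has domain X, by φ-inj.
  universalArrow-at-unit : ∀ {r} (rep : RepresentedBy PD r) (x : Fibre PD r) →
                           RepresentedBy.φ rep x S.≈ S.id → UniversalArrow P d
  universalArrow-at-unit rep ((X₀ , g₀) , refl) φx≈id = record
    { obj                = X₀
    ; ε                  = g₀
    ; transpose          = λ g → proj₁ (cone g)
    ; transpose-commutes = λ g → proj₂ (cone g)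
    ; transpose-unique   = λ k gk≈g →
        faithful (D.≈-trans (P-cone (k , gk≈g)) (D.≈-sym (P-cone (cone _))))
    }
    where
      open RepresentedBy rep
      x₀ : Fibre PD (P.F₀ X₀ , g₀)
      x₀ = (X₀ , g₀) , refl

      φ-reindexing : ∀ {a} {v : S.Hom a (P.F₀ X₀ , g₀)} (z : Fibre PD a) →
                     IsReindexing PD v z x₀ → φ z S.≈ v
      φ-reindexing {v = v} z reindexing = begin
        proj₁ (φ z)                   ≈⟨ natural v z x₀ reindexing ⟩
        proj₁ (φ x₀) D.∘ proj₁ v      ≈⟨ φx≈id ⟩∘⟨refl ⟩
        D.id D.∘ proj₁ v              ≈⟨ D.identityˡ ⟩
        proj₁ v                       ∎

      P-cone : ∀ {X g} (m : P↓d.Hom (X , g) (X₀ , g₀)) →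
               P.F₁ (proj₁ m) D.≈ proj₁ (φ ((X , g) , refl))
      P-cone m = D.≈-sym (φ-reindexing {v = Functor.F₁ PD m} _ (m , D.≈-refl))

      reindex-lift : ∀ {a g} (v : S.Hom (a , g) (P.F₀ X₀ , g₀)) → Lift P X₀ (proj₁ v) →
                     Σ[ z ∈ Fibre PD (a , g) ] IsReindexing PD v z x₀
      reindex-lift {g = g} (v , g₀v≈g) (X , k , refl , Pk≈v) =
        ((X , g) , refl) , (k , D.≈-trans (refl⟩∘⟨ Pk≈v) g₀v≈g) , Pk≈v

      cone : ∀ {X} (g : D.Hom (P.F₀ X) d) → P↓d.Hom (X , g) (X₀ , g₀)
      cone {X} g = into-y (reindex-lift (φ y) (lift X₀ (proj₁ (φ y))))
        where
          y : Fibre PD (P.F₀ X , g)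
          y = (X , g) , refl
          into-y : Σ[ z ∈ Fibre PD (P.F₀ X , g) ] IsReindexing PD (φ y) z x₀ →
                   P↓d.Hom (X , g) (X₀ , g₀)
          into-y (z , reindexing) = subst (λ c → P↓d.Hom c (X₀ , g₀))
                                          (φ-inj z y (φ-reindexing z reindexing)) (proj₁ reindexing)

  representable⇒universalArrow : CorrespondsToRepresentable PD → UniversalArrow P d
  representable⇒universalArrow (r , rep) =
    universalArrow-at-unit rep (proj₁ φ⁻¹id) (proj₂ φ⁻¹id)
    where
      φ⁻¹id : Σ[ x ∈ Fibre PD r ] RepresentedBy.φ rep x S.≈ S.id
      φ⁻¹id = RepresentedBy.φ-surj rep S.id

module Comonadicity {o ℓ e o′ ℓ′ e′ : Level}
         {C : Category o ℓ e} {D : Category o′ ℓ′ e′} (P : Functor C D)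
         (fib : IsDiscreteFibration P) {R : Functor D C} (adj : Adjunction P R) where
  private
    module C = Category C
    module D = Category D
    module P = Functor P
    module R = Functor R
    module 𝒜 = Category (Coalgebras adj)
    module K = Functor (Comparison adj)
  open Adjunction adj
  open Coalgebra
  open IsDiscreteFibration fib
  open DiscreteFibration P fib
  open Transport D
  open HomReasoning D

  -- K⁻¹ sends a coalgebra α : A → P R A to the domain of the lift of α at R A.
  module Underlying (A : Coalgebra adj) where
    lifted : Lift P (R.F₀ (carrier A)) (coact A)
    lifted = lift (R.F₀ (carrier A)) (coact A)

    obj : C.Obj
    obj = proj₁ lifted

    over : P.F₀ obj ≡ carrier A
    over = proj₁ (proj₂ (proj₂ lifted))

    ι : D.Hom (P.F₀ obj) (carrier A)
    ι = ≡⇒Hom over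

    ι⁻¹ : D.Hom (carrier A) (P.F₀ obj)
    ι⁻¹ = ≡⇒Hom (sym over)

    α̃ : C.Hom obj (R.F₀ (carrier A))
    α̃ = proj₁ (proj₂ lifted)

    P-α̃ : P.F₁ α̃ D.≈ coact A D.∘ ι
    P-α̃ = D.≈-trans (HomOver⇒≈ over refl (proj₂ (proj₂ (proj₂ lifted))))
                    (D.≈-trans (D.≈-sym D.identityˡ) (≡⇒Hom-natural over refl))

    -- by the counit law, α̃ is the transpose of ι
    ι-coalgebra-map : coact A D.∘ ι D.≈ P.F₁ (R.F₁ ι) D.∘ P.F₁ (unit obj)
    ι-coalgebra-map = D.≈-trans (D.≈-sym P-α̃) (D.≈-trans (P.F-resp-≈ α̃≈Rι∘η) P.homomorphism)
      where
        α̃≈Rι∘η : α̃ C.≈ R.F₁ ι C.∘ unit obj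
        α̃≈Rι∘η = transpose-unique α̃
          (D.≈-trans (refl⟩∘⟨ P-α̃) (D.≈-trans (pullˡ (counit-law A)) D.identityˡ))
          where open UniversalArrow (adjunction⇒universalArrow P adj (carrier A))

  open Underlying using (obj; over; ι; ι⁻¹; α̃; P-α̃)

  module _ {A B : Coalgebra adj} (f : 𝒜.Hom A B) where
    private
      f̂ : D.Hom (P.F₀ (obj A)) (P.F₀ (obj B))
      f̂ = transport (over A) (over B) (proj₁ f)

      square : P.F₁ (α̃ B) D.∘ f̂ D.≈ P.F₁ (R.F₁ (proj₁ f) C.∘ α̃ A)
      square = begin
        P.F₁ (α̃ B) D.∘ f̂                              ≈⟨ P-α̃ B ⟩∘⟨refl ⟩
        (coact B D.∘ ι B) D.∘ f̂                       ≈⟨ pullʳ (≡⇒Hom-natural (over A) (over B)) ⟩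
        coact B D.∘ (proj₁ f D.∘ ι A)                 ≈⟨ pullˡ (proj₂ f) ⟩
        (P.F₁ (R.F₁ (proj₁ f)) D.∘ coact A) D.∘ ι A   ≈⟨ pullʳ (D.≈-sym (P-α̃ A)) ⟩
        P.F₁ (R.F₁ (proj₁ f)) D.∘ P.F₁ (α̃ A)          ≈⟨ D.≈-sym P.homomorphism ⟩
        P.F₁ (R.F₁ (proj₁ f) C.∘ α̃ A)                 ∎

    K⁻¹₁ : C.Hom (obj A) (obj B)
    K⁻¹₁ = proj₁ (factor-lifts _ square)

    P-K⁻¹₁ : P.F₁ K⁻¹₁ D.≈ transport (over A) (over B) (proj₁ f)
    P-K⁻¹₁ = proj₂ (factor-lifts _ square)

  K⁻¹ : Functor (Coalgebras adj) C
  K⁻¹ = record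
    { F₀           = obj
    ; F₁           = λ {A} {B} → K⁻¹₁ {A} {B}
    ; identity     = λ {A} → faithful (D.≈-trans (P-K⁻¹₁ {A} {A} (𝒜.id {A}))
                       (D.≈-trans (transport-id (over A)) (D.≈-sym P.identity)))
    ; homomorphism = λ {A} {B} {C} {f} {g} → faithful (begin
        P.F₁ (K⁻¹₁ {A} {C} (𝒜._∘_ {A} {B} {C} g f))
            ≈⟨ P-K⁻¹₁ {A} {C} (𝒜._∘_ {A} {B} {C} g f) ⟩
        transport (over A) (over C) (proj₁ g D.∘ proj₁ f)
            ≈⟨ transport-∘ (over A) (over B) (over C) ⟩
        transport (over B) (over C) (proj₁ g) D.∘ transport (over A) (over B) (proj₁ f)
            ≈⟨ D.≈-sym (P-K⁻¹₁ {B} {C} g) ⟩∘⟨ D.≈-sym (P-K⁻¹₁ {A} {B} f) ⟩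
        P.F₁ (K⁻¹₁ {B} {C} g) D.∘ P.F₁ (K⁻¹₁ {A} {B} f)
            ≈⟨ D.≈-sym P.homomorphism ⟩
        P.F₁ (K⁻¹₁ {B} {C} g C.∘ K⁻¹₁ {A} {B} f)
            ∎)
    ; F-resp-≈     = λ {A} {B} {f} {g} f≈g → faithful (D.≈-trans (P-K⁻¹₁ {A} {B} f)
                       (D.≈-trans (transport-resp (over A) (over B) f≈g)
                                  (D.≈-sym (P-K⁻¹₁ {A} {B} g))))
    }

  KK⁻¹≅id : NaturalIsomorphism (Comparison adj ∘F K⁻¹) idF
  KK⁻¹≅id = record
    { η       = λ A → ι A , Underlying.ι-coalgebra-map A
    ; η⁻¹     = λ A → ι⁻¹ A , iso-square⁻¹ (P ∘F R)
                  (≡⇒Hom-invˡ (over A)) (≡⇒Hom-invʳ (over A)) (Underlying.ι-coalgebra-map A)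
    ; isoˡ    = λ A → ≡⇒Hom-invˡ (over A)
    ; isoʳ    = λ A → ≡⇒Hom-invʳ (over A)
    ; natural = λ {A} {B} f →
        D.≈-trans (refl⟩∘⟨ P-K⁻¹₁ {A} {B} f) (≡⇒Hom-natural (over A) (over B))
    }

  -- α̃ at K X is one lift of P η_X, and η_X itself is another.
  K⁻¹K-obj : ∀ X → obj (K.F₀ X) ≡ X
  K⁻¹K-obj X = proj₁ (unique (R.F₀ (P.F₀ X)) (P.F₁ (unit X))
                 (Underlying.lifted (K.F₀ X)) (X , unit X , refl , D.≈-refl))

  K⁻¹K≅id : NaturalIsomorphism (K⁻¹ ∘F Comparison adj) idF
  K⁻¹K≅id = record
    { η       = θ
    ; η⁻¹     = λ X → TC.≡⇒Hom (sym (K⁻¹K-obj X))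
    ; isoˡ    = λ X → TC.≡⇒Hom-invˡ (K⁻¹K-obj X)
    ; isoʳ    = λ X → TC.≡⇒Hom-invʳ (K⁻¹K-obj X)
    ; natural = natural
    }
    where
      module TC = Transport C
      θ : ∀ X → C.Hom (obj (K.F₀ X)) X
      θ X = TC.≡⇒Hom (K⁻¹K-obj X)

      natural : ∀ {X Y} (k : C.Hom X Y) →
                θ Y C.∘ K⁻¹₁ {K.F₀ X} {K.F₀ Y} (K.F₁ k) C.≈ k C.∘ θ X
      natural {X} {Y} k = faithful (begin
        P.F₁ (θ Y C.∘ K⁻¹₁ {K.F₀ X} {K.F₀ Y} (K.F₁ k))
            ≈⟨ P.homomorphism ⟩
        P.F₁ (θ Y) D.∘ P.F₁ (K⁻¹₁ {K.F₀ X} {K.F₀ Y} (K.F₁ k))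
            ≈⟨ F₁-≡⇒Hom P (K⁻¹K-obj Y) (over (K.F₀ Y))
                 ⟩∘⟨ P-K⁻¹₁ {K.F₀ X} {K.F₀ Y} (K.F₁ k) ⟩
        ≡⇒Hom (over (K.F₀ Y)) D.∘ transport (over (K.F₀ X)) (over (K.F₀ Y)) (P.F₁ k)
            ≈⟨ ≡⇒Hom-natural (over (K.F₀ X)) (over (K.F₀ Y)) ⟩
        P.F₁ k D.∘ ≡⇒Hom (over (K.F₀ X))
            ≈⟨ refl⟩∘⟨ D.≈-sym (F₁-≡⇒Hom P (K⁻¹K-obj X) (over (K.F₀ X))) ⟩
        P.F₁ k D.∘ P.F₁ (θ X)
            ≈⟨ D.≈-sym P.homomorphism ⟩
        P.F₁ (k C.∘ θ X)
            ∎)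

  comparison-equivalence : IsEquivalenceOfCategories (Comparison adj)
  comparison-equivalence = record { G = K⁻¹ ; F∘G≅1 = KK⁻¹≅id ; G∘F≅1 = K⁻¹K≅id }

mainTheorem16 : ∀ {o ℓ e o′ ℓ′ e′ : Level}
                  {C : Category o ℓ e} {D : Category o′ ℓ′ e′}
                  (P : Functor C D) → IsDiscreteFibration P →
                  let cond1 = ∀ (d : Category.Obj D) →
                                CorrespondsToRepresentable (PullbackAlongDom P d)
                      cond2 = HasRightAdjoint P
                      cond3 = IsComonadic P
                  in ((cond1 → cond2) × (cond2 → cond1))
                     × ((cond2 → cond3) × (cond3 → cond2))
mainTheorem16 P fib =
  ( (λ rep → universalArrows⇒rightAdjoint P (λ d → representable⇒universalArrow d (rep d)))
  , (λ { (R , adj) d → universalArrow⇒representable d (adjunction⇒universalArrow P adj d) }) )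
  , ( (λ { (R , adj) → R , adj , Comonadicity.comparison-equivalence P fib adj })
    , (λ { (R , adj , _) → R , adj }) )
  where open Representability P fib
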